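{- Let $S,Q$ be disjoint finite sets, $S',Q'$ disjoint copies of $S,Q$ (with $S,Q,S',Q'$ pairwise disjoint), $\mathcal M_{SQ}$ a matroid on $S\uplus Q$, and $\mathcal M_{QQ'}:=\mathcal M^*_{SQ}\leftrightarrow(\mathcal M_{SQ})_{SQ'}$ (a matroid on $Q\uplus Q'$). Then: \begin{enumerate} \item $\mathcal M^*_{QQ'}=(\mathcal M_{QQ'})_{Q'Q}$. \item $\mathcal M_{QQ'}\circ Q=\mathcal M^*_{SQ}\circ Q$ and $\mathcal M_{QQ'}\times Q=\mathcal M^*_{SQ}\times Q$. \item $(\mathcal M_{SQ}\leftrightarrow\mathcal M_{QQ'})\circ S=\mathcal M_{SQ}\circ S$ and $(\mathcal M_{SQ}\leftrightarrow\mathcal M_{QQ'})\circ Q'=(\mathcal M_{SQ}\circ Q)_{Q'}$. \item $(\mathcal M_{SQ}\leftrightarrow\mathcal M_{QQ'})\times S=\mathcal M_{SQ}\times S$ and $(\mathcal M_{SQ}\leftrightarrow\mathcal M_{QQ'})\times Q'=(\mathcal M_{SQ}\times Q)_{Q'}$. \item Every base of $(\mathcal M_{SQ})_{SQ'}$ is a base of $\mathcal M_{SQ}\leftrightarrow\mathcal M_{QQ'}$. \item The $\{S,Q\}$-completion of $\mathcal M_{SQ}$ is the family of bases of the matroid $(\mathcal M_{SQ}\leftrightarrow\mathcal M_{QQ'})_{SQ}=(\mathcal M_{SQ})_{SQ'}\leftrightarrow[(\mathcal M^*_{SQ})_{S'Q'}\leftrightarrow(\mathcal M_{SQ})_{S'Q}]$.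 \item The dual of (the matroid whose bases form) the $\{S,Q\}$-completion of $\mathcal M_{SQ}$ is (the matroid whose bases form) the $\{S,Q\}$-completion of $\mathcal M^*_{SQ}$. \end{enumerate}
   Context: For a matroid $\mathcal M$ on $X$ and $T\subseteq X$: $\mathcal M\circ T$ is the restriction to $T$ (delete $X-T$), $\mathcal M\times T$ the contraction to $T$ (contract $X-T$); $\mathcal M^*$ is the dual. $\mathbf 0_X$ is the matroid on $X$ whose only base is $\emptyset$. For matroids on the same set, $\mathcal M_1\vee\mathcal M_2$ has as bases the maximal sets $b_1\cup b_2$ with $b_i$ a base of $\mathcal M_i$. For pairwise disjoint $A,B,C$, the linking is $\mathcal M_{AB}\leftrightarrow\mathcal M_{BC}:=((\mathcal M_{AB}\oplus\mathbf 0_C)\vee(\mathcal M_{BC}\oplus\mathbf 0_A))\times(A\uplus C)$, a matroid on $A\uplus C$. Copies: if $X'$ is a disjoint copy of $X$ via a bijection $e\mapsto e'$, then $(\mathcal M_{XY})_{X'Y}$ is the matroid on $X'\uplus Y$ obtained by renaming each $e\in X$ to $e'$ (similarly for renaming several blocks, e.g. $(\mathcal M_{SQ})_{S'Q'}$), and $(\mathcal M_{QQ'})_{Q'Q}$ is obtained from $\mathcal M_{QQ'}$ by interchanging each $e\in Q$ with its copy $e'\in Q'$; $(\mathcal M_{SQ'})_{SQ}$ renames $Q'$ back to $Q$. The $\{S,Q\}$-completion of $\mathcal M_{SQ}$ is the family of all sets $b'_S\uplus b'_Q$ ($b'_S\subseteq S$, $b'_Q\subseteq Q$) for which there exist $b_S\subseteq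 S$, $b_Q\subseteq Q$ with $b_S\uplus b_Q$, $b'_S\uplus b_Q$, $b_S\uplus b'_Q$ all bases of $\mathcal M_{SQ}$ (this family contains all bases of $\mathcal M_{SQ}$). -}

module Defs where

open import Data.Bool using (Bool; true; false; not; _∨_)
open import Data.Sum using (_⊎_; inj₁; inj₂; [_,_]; swap; assocʳ)
open import Data.Product using (Σ; ∃; ∃-syntax; _×_; _,_)
open import Function using (_∘_; const)
open import Relation.Nullary using (¬_)
open import Relation.Binary.PropositionalEquality using (_≡_; _≢_)

Subset : Set → Set
Subset X = X → Bool

_∈_ : {X : Set} → X → Subset X → Set
x ∈ Z = Z x ≡ true

_⊆_ : {X : Set} → Subset X → Subset X → Set
Z ⊆ W = ∀ x → x ∈ Z → x ∈ W

_≗ˢ_ : {X : Set} → Subset X → Subset X → Set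
Z ≗ˢ W = ∀ x → Z x ≡ W x

_∪_ : {X : Set} → Subset X → Subset X → Subset X
(Z ∪ W) x = Z x ∨ W x

∁ : {X : Set} → Subset X → Subset X
∁ Z = not ∘ Z

Family : Set → Set₁
Family X = Subset X → Set

_≐_ : {X : Set} → Family X → Family X → Set
F ≐ G = ∀ Z → (F Z → G Z) × (G Z → F Z)

record Matroid (X : Set) : Set₁ where
  field
    IsBase   : Family X
    resp     : ∀ {Z W} → Z ≗ˢ W → IsBase Z → IsBase W
    nonempty : ∃[ B ] IsBase B
    exchange : ∀ {B₁ B₂} x → IsBase B₁ → IsBase B₂ → x ∈ B₁ → ¬ (x ∈ B₂) →
               ∃[ y ] (y ∈ B₂ × ¬ (y ∈ B₁) ×
                 ∃[ B ] (IsBase B × B y ≡ true × B x ≡ false ×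
                         (∀ z → z ≢ x → z ≢ y → B z ≡ B₁ z)))
open Matroid public

dual : {X : Set} → Family X → Family X
dual F Z = F (∁ Z)

Ind : {X : Set} → Family X → Subset X → Set
Ind F I = ∃[ B ] (F B × I ⊆ B)

MaxIndIn : {X : Set} → Family X → Subset X → Subset X → Set
MaxIndIn F T J = J ⊆ T × Ind F J ×
                 (∀ K → K ⊆ T → Ind F K → J ⊆ K → K ⊆ J)

-- restriction M ∘ T, where T ⊆ X is the image of e : T' → X with
-- characteristic function χ; the result lives on T'.
restrictAlong : {X T : Set} → (χ : Subset X) → (e : T → X) → Family X → Family T
restrictAlong χ e F I = ∃[ J ] (MaxIndIn F χ J × (∀ t → J (e t) ≡ I t))

-- contraction M × T := (M* ∘ T)*  (i.e. contract X - T)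
contractAlong : {X T : Set} → (χ : Subset X) → (e : T → X) → Family X → Family T
contractAlong χ e F = dual (restrictAlong χ e (dual F))

restrictL : {A B : Set} → Family (A ⊎ B) → Family A
restrictL = restrictAlong [ const true , const false ] inj₁

restrictR : {A B : Set} → Family (A ⊎ B) → Family B
restrictR = restrictAlong [ const false , const true ] inj₂

contractL : {A B : Set} → Family (A ⊎ B) → Family A
contractL = contractAlong [ const true , const false ] inj₁

contractR : {A B : Set} → Family (A ⊎ B) → Family B
contractR = contractAlong [ const false , const true ] inj₂

-- renaming along a bijection f : X → Y (the family on Y whose bases are
-- the images f(B) of bases B)
rename : {X Y : Set} → (X → Y) → Family X → Family Y
rename f F Z = F (Z ∘ f)

𝟘 : {X : Set} → Family X
𝟘 Z = ∀ x → Z x ≡ false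

_⊕_ : {A B : Set} → Family A → Family B → Family (A ⊎ B)
(F ⊕ G) Z = F (Z ∘ inj₁) × G (Z ∘ inj₂)

_∨ᴹ_ : {X : Set} → Family X → Family X → Family X
(F ∨ᴹ G) Z = (∃[ b₁ ] ∃[ b₂ ] (F b₁ × G b₂ × Z ≗ˢ (b₁ ∪ b₂))) ×
             (∀ b₁ b₂ → F b₁ → G b₂ → Z ⊆ (b₁ ∪ b₂) → (b₁ ∪ b₂) ⊆ Z)

-- linking  M_AB ↔ M_BC := ((M_AB ⊕ 0_C) ∨ (M_BC ⊕ 0_A)) × (A ⊎ C),
-- with ground set A ⊎ B ⊎ C represented as A ⊎ (B ⊎ C).
_↔ᴸ_ : {A B C : Set} → Family (A ⊎ B) → Family (B ⊎ C) → Family (A ⊎ C)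
_↔ᴸ_ {A} {B} {C} F G =
  contractAlong [ const true , [ const false , const true ] ]
                [ inj₁ , inj₂ ∘ inj₂ ]
                (rename assocʳ (F ⊕ 𝟘 {C}) ∨ᴹ (𝟘 {A} ⊕ G))

completion : {S Q : Set} → Family (S ⊎ Q) → Family (S ⊎ Q)
completion F Z = ∃[ bS ] ∃[ bQ ]
  (F [ bS , bQ ] × F [ Z ∘ inj₁ , bQ ] × F [ bS , Z ∘ inj₂ ])

-- The bases of a linking F ↔ᴸ H are the minimal traces on A ⊎ C of the maximal unions
-- of a base of F with a base of H. For M* ↔ M, exchanges inside the overlap and a
-- comparison of cardinalities show that these are exactly the sets (Q − C₁) ⊎ (C₂ ∩ Q')
-- for bases C₁, C₂ of M with the same S-part; this description is invariant under
-- duality combined with swapping Q and Q'. Linking M with it once more, the same two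
-- arguments give exactly the {S,Q}-completion, and every restriction, contraction and
-- duality statement is read off from these two descriptions.

module Submission where

open import Defs
open import Data.Nat using (ℕ; zero; suc; _+_; _≤_; _<_; z≤n)
open import Data.Nat.Properties
  using (≤-refl; ≤-trans; ≤-reflexive; +-mono-≤; +-monoˡ-≤; +-monoʳ-≤; +-cancelˡ-≤; +-cancelʳ-≤;
         +-cancelˡ-≡; +-suc; module ≤-Reasoning)
open import Data.Nat.Induction using (<-wellFounded)
open import Induction.WellFounded using (Acc; acc)
open import Data.Fin using (Fin; zero; suc)
import Data.Fin.Properties as Fin
open import Data.Bool using (Bool; true; false; not; _∨_; _∧_)
open import Data.Bool.Properties using (not-involutive; not-injective; ¬-not; ∨-identityʳ; ∨-zeroʳ)
import Data.Bool.Properties as Bool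
open import Data.Sum using (_⊎_; inj₁; inj₂; [_,_]; swap; assocʳ)
open import Data.Product using (∃; ∃-syntax; _×_; _,_; proj₁; proj₂)
open import Data.Empty using (⊥; ⊥-elim)
open import Function using (_∘_; const; id)
open import Relation.Nullary using (¬_; Dec; yes; no; ¬?; _×-dec_)
open import Relation.Nullary.Decidable using (decidable-stable)
open import Relation.Binary.Definitions using (DecidableEquality)
open import Relation.Unary using (Decidable)
import Data.Sum.Properties as Sum
open import Relation.Binary.PropositionalEquality
  using (_≡_; _≢_; _≗_; refl; sym; trans; cong; cong₂; subst)

private variable
  X : Set
  n : ℕ

true≢false : ∀ {b} → b ≡ true → b ≢ false
true≢false refl ()

not≡true : ∀ {b} → not b ≡ true → b ≡ false
not≡true = not-injective

not≡false : ∀ {b} → not b ≡ false → b ≡ true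
not≡false = not-injective

false≢true : ∀ {b} → b ≡ false → b ≢ true
false≢true e p = true≢false p e

∨-resolveˡ : ∀ {a b} → a ∨ b ≡ true → a ≡ false → b ≡ true
∨-resolveˡ a∨b refl = a∨b

∨-resolveʳ : ∀ {a b} → a ∨ b ≡ true → b ≡ false → a ≡ true
∨-resolveʳ {true}  _  _    = refl
∨-resolveʳ {false} () refl

contraposeᵇ : ∀ {a b} → (a ≡ true → b ≡ true) → b ≡ false → a ≡ false
contraposeᵇ {false} _ _ = refl
contraposeᵇ {true}  h e = ⊥-elim (true≢false (h refl) e)

≡-fromᵇ : ∀ {a b} → (a ≡ true → b ≡ true) → (b ≡ true → a ≡ true) → a ≡ b
≡-fromᵇ {true}          h _ = sym (h refl)
≡-fromᵇ {false} {true}  _ k = k refl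
≡-fromᵇ {false} {false} _ _ = refl

_∖_ : Subset X → Subset X → Subset X
(Z ∖ W) x = Z x ∧ not (W x)

∖-member : ∀ {Z W : Subset X} {x} → x ∈ (Z ∖ W) → x ∈ Z × W x ≡ false
∖-member {Z = Z} {W} {x} e with Z x | W x
... | true | false = refl , refl

∈-∖ : ∀ {Z W : Subset X} {x} → x ∈ Z → ¬ x ∈ W → x ∈ (Z ∖ W)
∈-∖ x∈Z x∉W rewrite x∈Z | ¬-not x∉W = refl

-- Counting subsets of Fin n

bit : Bool → ℕ
bit true  = 1
bit false = 0

∣_∣ : Subset (Fin n) → ℕ
∣_∣ {zero}  Z = 0
∣_∣ {suc n} Z = bit (Z zero) + ∣ Z ∘ suc ∣

count-cong : ∀ {Z W : Subset (Fin n)} → Z ≗ W → ∣ Z ∣ ≡ ∣ W ∣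
count-cong {zero}  h = refl
count-cong {suc n} h = cong₂ _+_ (cong bit (h zero)) (count-cong (h ∘ suc))

bit-mono : ∀ {a b} → (a ≡ true → b ≡ true) → bit a ≤ bit b
bit-mono {false} _ = z≤n
bit-mono {true}  h rewrite h refl = ≤-refl

count-mono : ∀ {Z W : Subset (Fin n)} → Z ⊆ W → ∣ Z ∣ ≤ ∣ W ∣
count-mono {zero}  h = z≤n
count-mono {suc n} h = +-mono-≤ (bit-mono (h zero)) (count-mono (h ∘ suc))

bit-reflects : ∀ {a b} → bit a ≤ bit b → a ≡ true → b ≡ true
bit-reflects {b = true}  _  _    = refl
bit-reflects {b = false} () refl

≤-squeeze : ∀ {a b c d} → a ≤ b → c ≤ d → b + d ≤ a + c → b ≤ a × d ≤ c
≤-squeeze {a} {b} {c} {d} a≤b c≤d le =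
  +-cancelʳ-≤ d b a (≤-trans le (+-monoʳ-≤ a c≤d)) ,
  +-cancelˡ-≤ b d c (≤-trans le (+-monoˡ-≤ c a≤b))

count-⊆-≥ : ∀ {Z W : Subset (Fin n)} → Z ⊆ W → ∣ W ∣ ≤ ∣ Z ∣ → W ⊆ Z
count-⊆-≥ {suc n} Z⊆W le x
  with ≤-squeeze (bit-mono (Z⊆W zero)) (count-mono (Z⊆W ∘ suc)) le
count-⊆-≥ {suc n} Z⊆W le zero    | head , _    = bit-reflects head
count-⊆-≥ {suc n} Z⊆W le (suc x) | _    , tail = count-⊆-≥ (Z⊆W ∘ suc) tail x

count-remove : ∀ {Z Z' : Subset (Fin n)} x → x ∈ Z → Z' x ≡ false →
               (∀ y → y ≢ x → Z' y ≡ Z y) → suc ∣ Z' ∣ ≡ ∣ Z ∣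
count-remove zero x∈Z x∉Z' rest rewrite x∈Z | x∉Z' =
  cong suc (count-cong (λ y → rest (suc y) λ ()))
count-remove {Z = Z} (suc x) x∈Z x∉Z' rest rewrite rest zero (λ ()) =
  trans (sym (+-suc (bit (Z zero)) _))
        (cong (bit (Z zero) +_)
              (count-remove x x∈Z x∉Z' (λ y y≢x → rest (suc y) (y≢x ∘ Fin.suc-injective))))

count-squeeze : ∀ {c₁ c₂ d₁ d₂ : Subset (Fin n)} → ∣ c₁ ∣ ≡ ∣ c₂ ∣ → ∣ d₂ ∣ ≤ ∣ d₁ ∣ →
                d₁ ⊆ c₁ → c₂ ⊆ d₂ → c₁ ⊆ d₁ × d₂ ⊆ c₂
count-squeeze c₁≡c₂ d₂≤d₁ d₁⊆c₁ c₂⊆d₂ =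
  count-⊆-≥ d₁⊆c₁ (≤-trans (≤-reflexive c₁≡c₂) (≤-trans (count-mono c₂⊆d₂) d₂≤d₁)) ,
  count-⊆-≥ c₂⊆d₂ (≤-trans d₂≤d₁ (≤-trans (count-mono d₁⊆c₁) (≤-reflexive c₁≡c₂)))

⊆-antisym : ∀ {Z W : Subset X} → Z ⊆ W → W ⊆ Z → Z ≗ W
⊆-antisym Z⊆W W⊆Z x = ≡-fromᵇ (Z⊆W x) (W⊆Z x)

⊆-reflexive : ∀ {Z W : Subset X} → Z ≗ W → Z ⊆ W
⊆-reflexive Z≗W x = trans (sym (Z≗W x))

⊆-trans : ∀ {Z W V : Subset X} → Z ⊆ W → W ⊆ V → Z ⊆ V
⊆-trans Z⊆W W⊆V x = W⊆V x ∘ Z⊆W x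

⊆-∁ : ∀ {Z W : Subset X} → Z ⊆ W → ∁ W ⊆ ∁ Z
⊆-∁ Z⊆W x x∉W = cong not (contraposeᵇ (Z⊆W x) (not≡true x∉W))

∁-⊆-reflect : ∀ {Z W : Subset X} → ∁ Z ⊆ ∁ W → W ⊆ Z
∁-⊆-reflect ∁Z⊆∁W x x∈W = not≡false (contraposeᵇ (∁Z⊆∁W x) (cong not x∈W))

⊆∁-sym : ∀ {Z W : Subset X} → Z ⊆ ∁ W → W ⊆ ∁ Z
⊆∁-sym Z⊆∁W x x∈W = cong not (contraposeᵇ (Z⊆∁W x) (cong not x∈W))

∁⊆-sym : ∀ {Z W : Subset X} → ∁ Z ⊆ W → ∁ W ⊆ Z
∁⊆-sym ∁Z⊆W x x∉W = not≡false (contraposeᵇ (∁Z⊆W x) (not≡true x∉W))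

∁-involutive : ∀ (Z : Subset X) → ∁ (∁ Z) ≗ Z
∁-involutive Z = not-involutive ∘ Z

⊆-resp-≗ : ∀ {Z Z' W W' : Subset X} → Z ≗ Z' → W ≗ W' → Z ⊆ W → Z' ⊆ W'
⊆-resp-≗ Z≗Z' W≗W' Z⊆W x z = trans (sym (W≗W' x)) (Z⊆W x (trans (Z≗Z' x) z))

∖-empty⇒⊆ : ∀ {Z W : Subset X} → ¬ (∃[ x ] x ∈ (Z ∖ W)) → Z ⊆ W
∖-empty⇒⊆ {Z = Z} {W} none x x∈Z with W x in e
... | true  = refl
... | false = ⊥-elim (none (x , ∈-∖ {Z = Z} {W} x∈Z (false≢true e)))

_∈?_ : ∀ (x : X) Z → Dec (x ∈ Z)
x ∈? Z = Z x Bool.≟ true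

module _ {m n : ℕ} where

  any? : ∀ {P : Fin m ⊎ Fin n → Set} → Decidable P → Dec (∃ P)
  any? P? with Fin.any? (P? ∘ inj₁) | Fin.any? (P? ∘ inj₂)
  ... | yes (a , pa) | _            = yes (inj₁ a , pa)
  ... | no  _        | yes (b , pb) = yes (inj₂ b , pb)
  ... | no  ¬pa      | no  ¬pb      =
    no λ { (inj₁ a , pa) → ¬pa (a , pa) ; (inj₂ b , pb) → ¬pb (b , pb) }

  _≟_ : DecidableEquality (Fin m ⊎ Fin n)
  _≟_ = Sum.≡-dec Fin._≟_ Fin._≟_

  size : Subset (Fin m ⊎ Fin n) → ℕ
  size Z = ∣ Z ∘ inj₁ ∣ + ∣ Z ∘ inj₂ ∣

  size-cong : ∀ {Z W} → Z ≗ W → size Z ≡ size W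
  size-cong h = cong₂ _+_ (count-cong (h ∘ inj₁)) (count-cong (h ∘ inj₂))

  size-remove : ∀ {Z Z'} x → x ∈ Z → Z' x ≡ false →
                (∀ y → y ≢ x → Z' y ≡ Z y) → suc (size Z') ≡ size Z
  size-remove (inj₁ a) a∈Z a∉Z' rest =
    cong₂ _+_ (count-remove a a∈Z a∉Z' (λ y y≢a → rest (inj₁ y) (y≢a ∘ Sum.inj₁-injective)))
              (count-cong (λ b → rest (inj₂ b) λ ()))
  size-remove (inj₂ b) b∈Z b∉Z' rest =
    trans (sym (+-suc _ _))
          (cong₂ _+_ (count-cong (λ a → rest (inj₁ a) λ ()))
                     (count-remove b b∈Z b∉Z' (λ y y≢b → rest (inj₂ y) (y≢b ∘ Sum.inj₂-injective))))

-- B' = B - x + y, in the shape returned by `exchange`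
Swapped : Subset X → X → X → Subset X → Set
Swapped B x y B' = y ∈ B' × B' x ≡ false × (∀ z → z ≢ x → z ≢ y → B' z ≡ B z)

module _ {B B' : Subset X} {x y : X} (sw : Swapped B x y B') where

  swapped-keeps : ¬ y ∈ B → ∀ z → z ≢ x → z ∈ B → z ∈ B'
  swapped-keeps y∉B z z≢x z∈B = trans (proj₂ (proj₂ sw) z z≢x z≢y) z∈B
    where z≢y : z ≢ y
          z≢y refl = y∉B z∈B

  swapped-back : ∀ z → z ≢ y → z ∈ B' → z ∈ B
  swapped-back z z≢y z∈B' = trans (sym (proj₂ (proj₂ sw) z z≢x z≢y)) z∈B'
    where z≢x : z ≢ x
          z≢x refl = true≢false z∈B' (proj₁ (proj₂ sw))

module _ {m n : ℕ} {B B' : Subset (Fin m ⊎ Fin n)} {x y} (sw : Swapped B x y B') where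

  swapped-size : x ∈ B → ¬ y ∈ B → size B' ≡ size B
  swapped-size x∈B y∉B = trans (sym (size-remove y y∈B' y∉B∩B' onlyY))
                               (size-remove x x∈B x∉B∩B' onlyX)
    where
    y∈B' = proj₁ sw
    B∩B' : Subset _
    B∩B' z = B z ∧ B' z
    keep : ∀ z → z ≢ x → z ≢ y → B' z ≡ B z
    keep = proj₂ (proj₂ sw)
    y∉B∩B' : B∩B' y ≡ false
    y∉B∩B' rewrite ¬-not y∉B = refl
    x∉B∩B' : B∩B' x ≡ false
    x∉B∩B' rewrite proj₁ (proj₂ sw) = Bool.∧-zeroʳ (B x)
    onlyY : ∀ z → z ≢ y → B∩B' z ≡ B' z
    onlyY z z≢y with B' z in e
    ... | false = Bool.∧-zeroʳ (B z)
    ... | true  = trans (cong (_∧ true) (trans (sym (keep z z≢x z≢y)) e)) refl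
      where z≢x : z ≢ x
            z≢x refl = true≢false e (proj₁ (proj₂ sw))
    onlyX : ∀ z → z ≢ x → B∩B' z ≡ B z
    onlyX z z≢x with B z in e
    ... | false = refl
    ... | true  = trans (keep z z≢x z≢y) e
      where z≢y : z ≢ y
            z≢y refl = y∉B e

  exchange-shrinks : ∀ {W} → x ∈ B → ¬ x ∈ W → y ∈ W → size (B' ∖ W) < size (B ∖ W)
  exchange-shrinks {W} x∈B x∉W y∈W =
    ≤-reflexive (size-remove x x∈B∖W x∉B'∖W agree)
    where
    x∈B∖W : x ∈ (B ∖ W)
    x∈B∖W rewrite x∈B | ¬-not x∉W = refl
    x∉B'∖W : (B' ∖ W) x ≡ false
    x∉B'∖W rewrite proj₁ (proj₂ sw) = refl
    agree : ∀ z → z ≢ x → (B' ∖ W) z ≡ (B ∖ W) z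
    agree z z≢x with W z in e
    ... | true  = trans (Bool.∧-zeroʳ (B' z)) (sym (Bool.∧-zeroʳ (B z)))
    ... | false = cong (_∧ true) (proj₂ (proj₂ sw) z z≢x z≢y)
      where z≢y : z ≢ y
            z≢y refl = true≢false y∈W e

module Bases {m n : ℕ} (M : Matroid (Fin m ⊎ Fin n)) where

  private
    E = Fin m ⊎ Fin n
    F = IsBase M

  bases-incomparable : ∀ {B₁ B₂} → IsBase M B₁ → IsBase M B₂ → B₁ ⊆ B₂ → B₂ ⊆ B₁
  bases-incomparable {B₁} b₁ b₂ B₁⊆B₂ x x∈B₂ with B₁ x in e
  ... | true  = refl
  ... | false with exchange M x b₂ b₁ x∈B₂ (false≢true e)
  ...   | y , y∈B₁ , y∉B₂ , _ = ⊥-elim (y∉B₂ (B₁⊆B₂ y y∈B₁))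

  bases-equisized : ∀ {B₁ B₂} → IsBase M B₁ → IsBase M B₂ → size B₁ ≡ size B₂
  bases-equisized {B₂ = B₂} b₁ b₂ = go (<-wellFounded _) b₁
    where
    go : ∀ {B : Subset E} → Acc _<_ (size (B ∖ B₂)) → F B → size B ≡ size B₂
    go {B} (acc rec) b with any? (λ x → x ∈? (B ∖ B₂))
    ... | no none = size-cong (⊆-antisym B⊆B₂ (bases-incomparable b b₂ B⊆B₂))
      where B⊆B₂ = ∖-empty⇒⊆ none
    ... | yes (x , x∈B∖B₂) with ∖-member {Z = B} {W = B₂} x∈B∖B₂
    ...   | x∈B , x∉B₂ with exchange M x b b₂ x∈B (false≢true x∉B₂)
    ...     | y , y∈B₂ , y∉B , B' , b' , sw =
      trans (sym (swapped-size sw x∈B y∉B))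
            (go (rec (exchange-shrinks sw {W = B₂} x∈B (false≢true x∉B₂) y∈B₂)) b')

  exchange-into : ∀ {B₁ B₂} x → F B₁ → F B₂ → x ∈ B₂ → ¬ x ∈ B₁ →
                  ∃[ y ] (y ∈ B₁ × ¬ y ∈ B₂ × ∃[ B ] (F B × Swapped B₁ y x B))
  exchange-into {B₁} {B₂} x b₁ b₂ x∈B₂ x∉B₁ = go (<-wellFounded _) b₂ x∈B₂ (λ _ _ z∈B₂ → z∈B₂)
    where
    -- walk from B₂ towards B₁, keeping x and B₁ ∩ B₂
    go : ∀ {B : Subset E} → Acc _<_ (size (B ∖ B₁)) → F B → x ∈ B →
         (∀ z → z ∈ B₁ → z ∈ B₂ → z ∈ B) →
         ∃[ y ] (y ∈ B₁ × ¬ y ∈ B₂ × ∃[ B' ] (F B' × Swapped B₁ y x B'))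
    go {B} (acc rec) b x∈B common with any? (λ z → z ∈? (B ∖ B₁) ×-dec ¬? (z ≟ x))
    ... | yes (z , z∈B∖B₁ , z≢x) with ∖-member {Z = B} {W = B₁} z∈B∖B₁
    ...   | z∈B , z∉B₁ with exchange M z b b₁ z∈B (false≢true z∉B₁)
    ...     | y , y∈B₁ , y∉B , B' , b' , sw =
      go (rec (exchange-shrinks sw {W = B₁} z∈B (false≢true z∉B₁) y∈B₁)) b'
         (swapped-keeps sw y∉B x (z≢x ∘ sym) x∈B)
         (λ w w∈B₁ w∈B₂ → swapped-keeps sw y∉B w (λ { refl → false≢true z∉B₁ w∈B₁ })
                                        (common w w∈B₁ w∈B₂))
    go {B} (acc rec) b x∈B common | no none with any? (λ y → y ∈? (B₁ ∖ B))
    ... | no none' = ⊥-elim (x∉B₁ (bases-incomparable b₁ b (∖-empty⇒⊆ none') x x∈B))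
    ... | yes (y , y∈B₁∖B) with ∖-member {Z = B₁} {W = B} y∈B₁∖B
    ...   | y∈B₁ , y∉B with exchange M y b₁ b y∈B₁ (false≢true y∉B)
    ...     | w , w∈B , w∉B₁ , B' , b' , sw =
      y , y∈B₁ , y∉B₂ , B' , b' , subst (λ v → Swapped B₁ y v B') w≡x sw
      where
      w≡x : w ≡ x
      w≡x = decidable-stable (w ≟ x) (λ w≢x → none (w , ∈-∖ {Z = B} {W = B₁} w∈B w∉B₁ , w≢x))
      y∉B₂ : ¬ y ∈ B₂
      y∉B₂ y∈B₂ = false≢true y∉B (common y y∈B₁ y∈B₂)

-- Restriction and contraction along an embedding

Extensional : Family X → Set
Extensional F = ∀ {Z W} → Z ≗ W → F Z → F W

≐-refl : ∀ {F : Family X} → F ≐ F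
≐-refl Z = id , id

≐-sym : ∀ {F G : Family X} → F ≐ G → G ≐ F
≐-sym F≐G Z = proj₂ (F≐G Z) , proj₁ (F≐G Z)

≐-trans : ∀ {F G H : Family X} → F ≐ G → G ≐ H → F ≐ H
≐-trans F≐G G≐H Z = proj₁ (G≐H Z) ∘ proj₁ (F≐G Z) , proj₂ (F≐G Z) ∘ proj₂ (G≐H Z)

Ind-mono : ∀ {F : Family X} {J K} → Ind F J → K ⊆ J → Ind F K
Ind-mono (B , b , J⊆B) K⊆J = B , b , λ x → J⊆B x ∘ K⊆J x

Ind-cong : ∀ {F G : Family X} → F ≐ G → Ind F ≐ Ind G
Ind-cong F≐G I = (λ (B , b , I⊆B) → B , proj₁ (F≐G B) b , I⊆B) ,
                 (λ (B , b , I⊆B) → B , proj₂ (F≐G B) b , I⊆B)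

≐-precomp : ∀ {Y : Set} {F G : Family X} (f : Subset Y → Subset X) → F ≐ G → (F ∘ f) ≐ (G ∘ f)
≐-precomp f F≐G = F≐G ∘ f

Maximal : Family X → Family X
Maximal P I = P I × (∀ K → P K → I ⊆ K → K ⊆ I)

Maximal-cong : ∀ {P Q : Family X} → P ≐ Q → Maximal P ≐ Maximal Q
Maximal-cong P≐Q I =
  (λ (p , max) → proj₁ (P≐Q I) p , λ K q → max K (proj₂ (P≐Q K) q)) ,
  (λ (q , max) → proj₂ (P≐Q I) q , λ K p → max K (proj₁ (P≐Q K) p))

-- e maps T bijectively onto χ, and extend I is the image of I under e
record Embedding {X T : Set} (χ : Subset X) (e : T → X) : Set where
  field
    extend   : Subset T → Subset X
    extend-χ : ∀ I → extend I ⊆ χ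
    extend-e : ∀ I → extend I ∘ e ≗ I
    extend-⊆ : ∀ {I J} → I ⊆ (J ∘ e) → extend I ⊆ J
    ⊆-extend : ∀ {I J} → J ⊆ χ → (J ∘ e) ⊆ I → J ⊆ extend I

module _ {X T : Set} {χ : Subset X} {e : T → X} (ι : Embedding χ e) (F : Family X) where
  open Embedding ι

  restrictAlong≐maximal : restrictAlong χ e F ≐ Maximal (Ind F ∘ extend)
  restrictAlong≐maximal I = to , from
    where
    to : restrictAlong χ e F I → Maximal (Ind F ∘ extend) I
    to (J , (J⊆χ , indJ , maxJ) , J∘e≗I) =
      Ind-mono indJ (extend-⊆ λ t → subst (_≡ true) (sym (J∘e≗I t))) ,
      λ K indK I⊆K t t∈K →
        let J⊆K = ⊆-extend J⊆χ (λ t j → I⊆K t (subst (_≡ true) (J∘e≗I t) j))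
        in subst (_≡ true) (J∘e≗I t)
             (maxJ (extend K) (extend-χ K) indK J⊆K (e t) (trans (extend-e K t) t∈K))
    from : Maximal (Ind F ∘ extend) I → restrictAlong χ e F I
    from (indI , maxI) = extend I , (extend-χ I , indI , max) , extend-e I
      where
      max : ∀ K → K ⊆ χ → Ind F K → extend I ⊆ K → K ⊆ extend I
      max K K⊆χ indK I⊆K = ⊆-extend K⊆χ
        (maxI (K ∘ e) (Ind-mono indK (extend-⊆ λ _ k → k))
              (λ t i → I⊆K (e t) (trans (extend-e I t) i)))

restrictAlong-transfer : ∀ {X Y T : Set} {χ₁ e₁ χ₂ e₂} (ι₁ : Embedding {X} {T} χ₁ e₁)
  (ι₂ : Embedding {Y} {T} χ₂ e₂) {F : Family X} {G : Family Y} →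
  (Ind F ∘ Embedding.extend ι₁) ≐ (Ind G ∘ Embedding.extend ι₂) →
  restrictAlong χ₁ e₁ F ≐ restrictAlong χ₂ e₂ G
restrictAlong-transfer ι₁ ι₂ h =
  ≐-trans (restrictAlong≐maximal ι₁ _) (≐-trans (Maximal-cong h) (≐-sym (restrictAlong≐maximal ι₂ _)))

leftEmbedding : ∀ {A B : Set} → Embedding {A ⊎ B} [ const true , const false ] inj₁
leftEmbedding = record
  { extend   = λ I → [ I , const false ]
  ; extend-χ = λ { I (inj₁ _) _ → refl ; I (inj₂ _) () }
  ; extend-e = λ _ _ → refl
  ; extend-⊆ = λ { I⊆J (inj₁ a) → I⊆J a ; _ (inj₂ _) () }
  ; ⊆-extend = λ { _ J⊆I (inj₁ a) → J⊆I a
                 ; J⊆χ _ (inj₂ b) j → ⊥-elim (true≢false (J⊆χ (inj₂ b) j) refl) }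
  }

rightEmbedding : ∀ {A B : Set} → Embedding {A ⊎ B} [ const false , const true ] inj₂
rightEmbedding = record
  { extend   = λ I → [ const false , I ]
  ; extend-χ = λ { I (inj₁ _) () ; I (inj₂ _) _ → refl }
  ; extend-e = λ _ _ → refl
  ; extend-⊆ = λ { _ (inj₁ _) () ; I⊆J (inj₂ b) → I⊆J b }
  ; ⊆-extend = λ { J⊆χ _ (inj₁ a) j → ⊥-elim (true≢false (J⊆χ (inj₁ a) j) refl)
                 ; _ J⊆I (inj₂ b) → J⊆I b }
  }

outerEmbedding : ∀ {A B C : Set} →
  Embedding {A ⊎ (B ⊎ C)} [ const true , [ const false , const true ] ] [ inj₁ , inj₂ ∘ inj₂ ]
outerEmbedding = record
  { extend   = λ I → [ I ∘ inj₁ , [ const false , I ∘ inj₂ ] ]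
  ; extend-χ = λ { I (inj₁ _) _ → refl ; I (inj₂ (inj₁ _)) () ; I (inj₂ (inj₂ _)) _ → refl }
  ; extend-e = λ { _ (inj₁ _) → refl ; _ (inj₂ _) → refl }
  ; extend-⊆ = λ { I⊆J (inj₁ a) → I⊆J (inj₁ a) ; _ (inj₂ (inj₁ _)) ()
                 ; I⊆J (inj₂ (inj₂ c)) → I⊆J (inj₂ c) }
  ; ⊆-extend = λ { _ J⊆I (inj₁ a) → J⊆I (inj₁ a)
                 ; J⊆χ _ (inj₂ (inj₁ b)) j → ⊥-elim (true≢false (J⊆χ (inj₂ (inj₁ b)) j) refl)
                 ; _ J⊆I (inj₂ (inj₂ c)) → J⊆I (inj₂ c) }
  }

MinimalTrace : {X T : Set} → (T → X) → Family X → Family T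
MinimalTrace e G Z = (∃[ W ] (G W × (W ∘ e) ⊆ Z)) × (∀ W → G W → (W ∘ e) ⊆ Z → Z ⊆ (W ∘ e))

MinimalTrace-cong : ∀ {X T : Set} {e : T → X} {G G' : Family X} →
                    G ≐ G' → MinimalTrace e G ≐ MinimalTrace e G'
MinimalTrace-cong G≐G' Z =
  (λ ((W , w , W⊆Z) , min) → (W , proj₁ (G≐G' W) w , W⊆Z) , λ W' → min W' ∘ proj₂ (G≐G' W')) ,
  (λ ((W , w , W⊆Z) , min) → (W , proj₂ (G≐G' W) w , W⊆Z) , λ W' → min W' ∘ proj₁ (G≐G' W'))

module _ {X T : Set} {χ : Subset X} {e : T → X} (ι : Embedding χ e)
         {G : Family X} (G-ext : Extensional G) where
  open Embedding ι

  private
    Avoids : Family T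
    Avoids I = ∃[ W ] (G W × I ⊆ ∁ (W ∘ e))

    Ind-dual≐Avoids : (Ind (dual G) ∘ extend) ≐ Avoids
    Ind-dual≐Avoids I =
      (λ (B , b , I⊆B) → ∁ B , b ,
                          λ t i → trans (not-involutive _) (I⊆B (e t) (trans (extend-e I t) i))) ,
      (λ (W , w , I⊆∁W) → ∁ W , G-ext (λ x → sym (∁-involutive W x)) w , extend-⊆ I⊆∁W)

    maximalAvoids≐minimalTrace : (Maximal Avoids ∘ ∁) ≐ MinimalTrace e G
    maximalAvoids≐minimalTrace Z = to , from
      where
      to : Maximal Avoids (∁ Z) → MinimalTrace e G Z
      to ((W , w , ∁Z⊆∁W) , max) =
        (W , w , ∁-⊆-reflect ∁Z⊆∁W) ,
        λ W' w' W'⊆Z → ∁-⊆-reflect (max (∁ (W' ∘ e)) (W' , w' , λ _ → id) (⊆-∁ W'⊆Z))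
      from : MinimalTrace e G Z → Maximal Avoids (∁ Z)
      from ((W , w , W⊆Z) , min) =
        (W , w , ⊆-∁ W⊆Z) ,
        λ K (W' , w' , K⊆∁W') ∁Z⊆K →
          let Z⊆W' = min W' w' (⊆-trans (⊆∁-sym K⊆∁W') (∁⊆-sym ∁Z⊆K))
          in ⊆-trans K⊆∁W' (⊆-∁ Z⊆W')

  contractAlong≐minimalTrace : contractAlong χ e G ≐ MinimalTrace e G
  contractAlong≐minimalTrace Z =
    proj₁ avoid ∘ proj₁ maximal ∘ proj₁ restricted , proj₂ restricted ∘ proj₂ maximal ∘ proj₂ avoid
    where
    restricted = restrictAlong≐maximal ι (dual G) (∁ Z)
    maximal    = Maximal-cong Ind-dual≐Avoids (∁ Z)
    avoid      = maximalAvoids≐minimalTrace Z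

-- Linking as minimal outer parts of maximal glued pairs

module Glue {A B C : Set} where

  glue : Subset (A ⊎ B) → Subset (B ⊎ C) → Subset (A ⊎ (B ⊎ C))
  glue P R (inj₁ a)        = P (inj₁ a)
  glue P R (inj₂ (inj₁ b)) = P (inj₂ b) ∨ R (inj₁ b)
  glue P R (inj₂ (inj₂ c)) = R (inj₂ c)

  outer : Subset (A ⊎ B) → Subset (B ⊎ C) → Subset (A ⊎ C)
  outer P R = [ P ∘ inj₁ , R ∘ inj₂ ]

  IsMaximalGlue : Family (A ⊎ B) → Family (B ⊎ C) → Subset (A ⊎ B) → Subset (B ⊎ C) → Set
  IsMaximalGlue F H P R =
    F P × H R × (∀ P' R' → F P' → H R' → glue P R ⊆ glue P' R' → glue P' R' ⊆ glue P R)

  MaximalGlue : Family (A ⊎ B) → Family (B ⊎ C) → Family (A ⊎ (B ⊎ C))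
  MaximalGlue F H W = ∃[ P ] ∃[ R ] (IsMaximalGlue F H P R × W ≗ glue P R)

  LinkBase : Family (A ⊎ B) → Family (B ⊎ C) → Family (A ⊎ C)
  LinkBase F H Z = (∃[ P ] ∃[ R ] (IsMaximalGlue F H P R × outer P R ⊆ Z)) ×
                   (∀ P R → IsMaximalGlue F H P R → outer P R ⊆ Z → Z ⊆ outer P R)

  LinkBase-congʳ : ∀ {F H H'} → H ≐ H' → LinkBase F H ≐ LinkBase F H'
  LinkBase-congʳ {F} {H} {H'} H≐H' Z =
    (λ ((P , R , mg , o⊆Z) , min) → (P , R , to mg , o⊆Z) , λ P' R' → min P' R' ∘ from) ,
    (λ ((P , R , mg , o⊆Z) , min) → (P , R , from mg , o⊆Z) , λ P' R' → min P' R' ∘ to)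
    where
    to : ∀ {P R} → IsMaximalGlue F H P R → IsMaximalGlue F H' P R
    to (f , h , max) = f , proj₁ (H≐H' _) h , λ P' R' f' h' → max P' R' f' (proj₂ (H≐H' R') h')
    from : ∀ {P R} → IsMaximalGlue F H' P R → IsMaximalGlue F H P R
    from (f , h , max) = f , proj₂ (H≐H' _) h , λ P' R' f' h' → max P' R' f' (proj₁ (H≐H' R') h')

  private
    lift₁ : Subset (A ⊎ B) → Subset (A ⊎ (B ⊎ C))
    lift₁ P = [ P ∘ inj₁ , [ P ∘ inj₂ , const false ] ]

    lift₂ : Subset (B ⊎ C) → Subset (A ⊎ (B ⊎ C))
    lift₂ R = [ const false , R ]

    unlift₁ : Subset (A ⊎ (B ⊎ C)) → Subset (A ⊎ B)
    unlift₁ b₁ = b₁ ∘ assocʳ ∘ inj₁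

    lift-∪ : ∀ P R → (lift₁ P ∪ lift₂ R) ≗ glue P R
    lift-∪ P R (inj₁ a)        = ∨-identityʳ _
    lift-∪ P R (inj₂ (inj₁ b)) = refl
    lift-∪ P R (inj₂ (inj₂ c)) = refl

    ∪-glue : ∀ b₁ b₂ → 𝟘 (b₁ ∘ assocʳ ∘ inj₂) → 𝟘 {A} (b₂ ∘ inj₁) →
             (b₁ ∪ b₂) ≗ glue (unlift₁ b₁) (b₂ ∘ inj₂)
    ∪-glue b₁ b₂ _   b₂₀ (inj₁ a)        = trans (cong (b₁ (inj₁ a) ∨_) (b₂₀ a)) (∨-identityʳ _)
    ∪-glue b₁ b₂ _   _   (inj₂ (inj₁ b)) = refl
    ∪-glue b₁ b₂ b₁₀ _   (inj₂ (inj₂ c)) = cong (_∨ b₂ (inj₂ (inj₂ c))) (b₁₀ c)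

  module _ {F : Family (A ⊎ B)} {H : Family (B ⊎ C)} (F-ext : Extensional F) where

    private
      U : Family (A ⊎ (B ⊎ C))
      U = rename assocʳ (F ⊕ 𝟘 {C}) ∨ᴹ (𝟘 {A} ⊕ H)

      lift₁-base : ∀ {P} → F P → rename assocʳ (F ⊕ 𝟘 {C}) (lift₁ P)
      lift₁-base f = F-ext (λ { (inj₁ _) → refl ; (inj₂ _) → refl }) f , λ _ → refl

    union≐maximalGlue : U ≐ MaximalGlue F H
    union≐maximalGlue W = to , from
      where
      to : U W → MaximalGlue F H W
      to ((b₁ , b₂ , (f , b₁₀) , (b₂₀ , h) , W≗) , max) =
        unlift₁ b₁ , b₂ ∘ inj₂ ,
        (f , h , λ P' R' f' h' ⊆glue →
           ⊆-resp-≗ (lift-∪ P' R') W≗glue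
             (max (lift₁ P') (lift₂ R') (lift₁-base f') ((λ _ → refl) , h')
                  (⊆-resp-≗ (sym ∘ W≗glue) (sym ∘ lift-∪ P' R') ⊆glue))) ,
        W≗glue
        where
        W≗glue : W ≗ glue (unlift₁ b₁) (b₂ ∘ inj₂)
        W≗glue x = trans (W≗ x) (∪-glue b₁ b₂ b₁₀ b₂₀ x)
      from : MaximalGlue F H W → U W
      from (P , R , (f , h , max) , W≗glue) =
        (lift₁ P , lift₂ R , lift₁-base f , ((λ _ → refl) , h) ,
         λ x → trans (W≗glue x) (sym (lift-∪ P R x))) ,
        λ b₁ b₂ (f' , b₁₀) (b₂₀ , h') W⊆ →
          ⊆-resp-≗ (sym ∘ ∪-glue b₁ b₂ b₁₀ b₂₀) (sym ∘ W≗glue)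
            (max (unlift₁ b₁) (b₂ ∘ inj₂) f' h'
                 (⊆-resp-≗ W≗glue (∪-glue b₁ b₂ b₁₀ b₂₀) W⊆))

    private
      MaximalGlue-ext : Extensional (MaximalGlue F H)
      MaximalGlue-ext Z≗W (P , R , mg , Z≗glue) = P , R , mg , λ x → trans (sym (Z≗W x)) (Z≗glue x)

      U-ext : Extensional U
      U-ext Z≗W u = proj₂ (union≐maximalGlue _) (MaximalGlue-ext Z≗W (proj₁ (union≐maximalGlue _) u))

      e : A ⊎ C → A ⊎ (B ⊎ C)
      e = [ inj₁ , inj₂ ∘ inj₂ ]

      trace≗outer : ∀ {W P R} → W ≗ glue P R → (W ∘ e) ≗ outer P R
      trace≗outer W≗glue (inj₁ a) = W≗glue (inj₁ a)
      trace≗outer W≗glue (inj₂ c) = W≗glue (inj₂ (inj₂ c))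

      minimalTrace≐LinkBase : MinimalTrace e (MaximalGlue F H) ≐ LinkBase F H
      minimalTrace≐LinkBase Z = to , from
        where
        to : MinimalTrace e (MaximalGlue F H) Z → LinkBase F H Z
        to ((W , (P , R , mg , W≗glue) , W⊆Z) , min) =
          (P , R , mg , ⊆-resp-≗ (trace≗outer W≗glue) (λ _ → refl) W⊆Z) ,
          λ P' R' mg' o⊆Z → ⊆-resp-≗ (λ _ → refl) (trace≗outer (λ _ → refl))
            (min (glue P' R') (P' , R' , mg' , λ _ → refl)
                 (⊆-resp-≗ (sym ∘ trace≗outer (λ _ → refl)) (λ _ → refl) o⊆Z))
        from : LinkBase F H Z → MinimalTrace e (MaximalGlue F H) Z
        from ((P , R , mg , o⊆Z) , min) =
          (glue P R , (P , R , mg , λ _ → refl) ,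
           ⊆-resp-≗ (sym ∘ trace≗outer (λ _ → refl)) (λ _ → refl) o⊆Z) ,
          λ W (P' , R' , mg' , W≗glue) W⊆Z →
            ⊆-resp-≗ (λ _ → refl) (sym ∘ trace≗outer W≗glue)
              (min P' R' mg' (⊆-resp-≗ (trace≗outer W≗glue) (λ _ → refl) W⊆Z))

    linking≐LinkBase : (F ↔ᴸ H) ≐ LinkBase F H
    linking≐LinkBase =
      ≐-trans (contractAlong≐minimalTrace outerEmbedding U-ext)
              (≐-trans (MinimalTrace-cong union≐maximalGlue) minimalTrace≐LinkBase)

  -- exchanging an element of B shared by P and R towards D would enlarge the glue
  glue-coverˡ : (M : Matroid (A ⊎ B)) {H : Family (B ⊎ C)} {P : Subset (A ⊎ B)} {R : Subset (B ⊎ C)} →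
    IsMaximalGlue (IsBase M) H P R → ∀ {D} → IsBase M D → (∀ b → D (inj₂ b) ≡ not (R (inj₁ b))) →
    (P ∘ inj₂) ⊆ (D ∘ inj₂)
  glue-coverˡ M {P = P} {R} (p , h , max) {D} d D≡∁R b b∈P with D (inj₂ b) in eD
  ... | true  = refl
  ... | false with exchange M (inj₂ b) p d b∈P (false≢true eD)
  ...   | y , y∈D , y∉P , P' , p' , sw = ⊥-elim (escapes y y∈D y∉P (proj₁ sw))
    where
    b∈R : R (inj₁ b) ≡ true
    b∈R = not≡false (trans (sym (D≡∁R b)) eD)
    grow : glue P R ⊆ glue P' R
    grow (inj₁ a) x = swapped-keeps sw y∉P (inj₁ a) (λ ()) x
    grow (inj₂ (inj₁ b')) x with R (inj₁ b') in eR
    ... | true  = ∨-zeroʳ _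
    ... | false = trans (∨-identityʳ _) (swapped-keeps sw y∉P (inj₂ b') b'≢b
                                           (trans (sym (∨-identityʳ _)) x))
      where b'≢b : inj₂ b' ≢ inj₂ b
            b'≢b refl = true≢false b∈R eR
    grow (inj₂ (inj₂ c)) x = x
    escapes : ∀ y → y ∈ D → ¬ y ∈ P → y ∈ P' → ⊥
    escapes (inj₁ a)  _   y∉P y∈P' = y∉P (max P' R p' h grow (inj₁ a) y∈P')
    escapes (inj₂ b') y∈D y∉P y∈P' =
      true≢false (max P' R p' h grow (inj₂ (inj₁ b')) (cong (_∨ R (inj₁ b')) y∈P'))
                 (cong₂ _∨_ (¬-not y∉P) (not≡true (trans (sym (D≡∁R b')) y∈D)))

  glue-coverʳ : (M : Matroid (B ⊎ C)) {F : Family (A ⊎ B)} {P : Subset (A ⊎ B)} {R : Subset (B ⊎ C)} →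
    IsMaximalGlue F (IsBase M) P R → ∀ {D} → IsBase M D → (∀ b → D (inj₁ b) ≡ not (P (inj₂ b))) →
    (R ∘ inj₁) ⊆ (D ∘ inj₁)
  glue-coverʳ M {P = P} {R} (f , r , max) {D} d D≡∁P b b∈R with D (inj₁ b) in eD
  ... | true  = refl
  ... | false with exchange M (inj₁ b) r d b∈R (false≢true eD)
  ...   | y , y∈D , y∉R , R' , r' , sw = ⊥-elim (escapes y y∈D y∉R (proj₁ sw))
    where
    b∈P : P (inj₂ b) ≡ true
    b∈P = not≡false (trans (sym (D≡∁P b)) eD)
    grow : glue P R ⊆ glue P R'
    grow (inj₁ a) x = x
    grow (inj₂ (inj₁ b')) x with P (inj₂ b') in eP
    ... | true  = refl
    ... | false = swapped-keeps sw y∉R (inj₁ b') b'≢b x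
      where b'≢b : inj₁ b' ≢ inj₁ b
            b'≢b refl = true≢false b∈P eP
    grow (inj₂ (inj₂ c)) x = swapped-keeps sw y∉R (inj₂ c) (λ ()) x
    escapes : ∀ y → y ∈ D → ¬ y ∈ R → y ∈ R' → ⊥
    escapes (inj₁ b') y∈D y∉R y∈R' =
      true≢false (max P R' f r' grow (inj₂ (inj₁ b')) (trans (cong (P (inj₂ b') ∨_) y∈R') (∨-zeroʳ _)))
                 (cong₂ _∨_ (not≡true (trans (sym (D≡∁P b')) y∈D)) (¬-not y∉R))
    escapes (inj₂ c)  _   y∉R y∈R' = y∉R (max P R' f r' grow (inj₂ (inj₂ c)) y∈R')

-- The {S,Q}-completion

module _ {A B : Set} {G : Family (A ⊎ B)} (G-ext : Extensional G) where

  base⇒completion : ∀ {Z} → G Z → completion G Z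
  base⇒completion {Z} g = Z ∘ inj₁ , Z ∘ inj₂ , g' , g' , g'
    where g' = G-ext (λ { (inj₁ _) → refl ; (inj₂ _) → refl }) g

  completion-Indˡ : (Ind (completion G) ∘ Embedding.extend leftEmbedding) ≐ (Ind G ∘ Embedding.extend leftEmbedding)
  completion-Indˡ I =
    (λ (Z , (_ , bQ , _ , g , _) , I⊆Z) →
       [ Z ∘ inj₁ , bQ ] , g , λ { (inj₁ a) → I⊆Z (inj₁ a) ; (inj₂ _) () }) ,
    (λ (Z , g , I⊆Z) → Z , base⇒completion g , I⊆Z)

  completion-Indʳ : (Ind (completion G) ∘ Embedding.extend rightEmbedding) ≐ (Ind G ∘ Embedding.extend rightEmbedding)
  completion-Indʳ I =
    (λ (Z , (bS , _ , _ , _ , g) , I⊆Z) →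
       [ bS , Z ∘ inj₂ ] , g , λ { (inj₁ _) () ; (inj₂ b) → I⊆Z (inj₂ b) }) ,
    (λ (Z , g , I⊆Z) → Z , base⇒completion g , I⊆Z)

  completion-dual : dual (completion G) ≐ completion (dual G)
  completion-dual Z = to , from
    where
    to : completion G (∁ Z) → completion (dual G) Z
    to (bS , bQ , g₁ , g₂ , g₃) = ∁ bS , ∁ bQ ,
      G-ext (λ { (inj₁ _) → sym (not-involutive _) ; (inj₂ _) → sym (not-involutive _) }) g₁ ,
      G-ext (λ { (inj₁ _) → refl ; (inj₂ _) → sym (not-involutive _) }) g₂ ,
      G-ext (λ { (inj₁ _) → sym (not-involutive _) ; (inj₂ _) → refl }) g₃
    from : completion (dual G) Z → completion G (∁ Z)
    from (bS , bQ , g₁ , g₂ , g₃) = ∁ bS , ∁ bQ ,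
      G-ext (λ { (inj₁ _) → refl ; (inj₂ _) → refl }) g₁ ,
      G-ext (λ { (inj₁ _) → refl ; (inj₂ _) → refl }) g₂ ,
      G-ext (λ { (inj₁ _) → refl ; (inj₂ _) → refl }) g₃

mirror : ∀ {A B : Set} → Subset (A ⊎ B) → Subset (B ⊎ A)
mirror Z = ∁ (Z ∘ swap)

module Completion {s q : ℕ} (M : Matroid (Fin s ⊎ Fin q)) where
  open Bases M
  open Glue

  private
    E = Fin s ⊎ Fin q
    F = IsBase M
    F* = rename swap (dual F)

  mirror-base : ∀ {C} → F C → F* (mirror C)
  mirror-base = resp M (λ { (inj₁ _) → sym (not-involutive _) ; (inj₂ _) → sym (not-involutive _) })

  bases-S≤⇒Q≥ : ∀ {B₁ B₂} → F B₁ → F B₂ → ∣ B₁ ∘ inj₁ ∣ ≤ ∣ B₂ ∘ inj₁ ∣ → ∣ B₂ ∘ inj₂ ∣ ≤ ∣ B₁ ∘ inj₂ ∣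
  bases-S≤⇒Q≥ b₁ b₂ le = +-cancelˡ-≤ _ _ _
    (≤-trans (≤-reflexive (sym (bases-equisized b₁ b₂))) (+-monoˡ-≤ _ le))

  bases-Q≤⇒S≥ : ∀ {B₁ B₂} → F B₁ → F B₂ → ∣ B₁ ∘ inj₂ ∣ ≤ ∣ B₂ ∘ inj₂ ∣ → ∣ B₂ ∘ inj₁ ∣ ≤ ∣ B₁ ∘ inj₁ ∣
  bases-Q≤⇒S≥ b₁ b₂ le = +-cancelʳ-≤ _ _ _
    (≤-trans (≤-reflexive (sym (bases-equisized b₁ b₂))) (+-monoʳ-≤ _ le))

  Twins : Subset E → Subset E → Set
  Twins C₁ C₂ = F C₁ × F C₂ × (C₁ ∘ inj₁) ≗ (C₂ ∘ inj₁)

  twins-Q-size : ∀ {C₁ C₂} → Twins C₁ C₂ → ∣ C₁ ∘ inj₂ ∣ ≡ ∣ C₂ ∘ inj₂ ∣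
  twins-Q-size (c₁ , c₂ , S≗) = +-cancelˡ-≡ _ _ _
    (trans (cong (_+ _) (sym (count-cong S≗))) (bases-equisized c₁ c₂))

  twinSet : Subset E → Subset E → Subset (Fin q ⊎ Fin q)
  twinSet C₁ C₂ = [ ∁ (C₁ ∘ inj₂) , C₂ ∘ inj₂ ]

  TwinBases : Family (Fin q ⊎ Fin q)
  TwinBases Z = ∃[ C₁ ] ∃[ C₂ ] (Twins C₁ C₂ × Z ≗ twinSet C₁ C₂)

  twinSet-incomparable : ∀ {C₁ C₂ D₁ D₂} → Twins C₁ C₂ → Twins D₁ D₂ →
                         twinSet D₁ D₂ ⊆ twinSet C₁ C₂ → twinSet C₁ C₂ ⊆ twinSet D₁ D₂
  twinSet-incomparable {D₁ = D₁} tc td D⊆C = λ where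
      (inj₁ b) → ⊆-∁ (proj₁ squeeze) b
      (inj₂ b) → proj₂ squeeze b
    where
    squeeze = count-squeeze {c₁ = D₁ ∘ inj₂} (twins-Q-size td) (≤-reflexive (sym (twins-Q-size tc)))
                (∁-⊆-reflect (λ b → D⊆C (inj₁ b))) (λ b → D⊆C (inj₂ b))

  twins⇒maximalGlue* : ∀ {C₁ C₂} → Twins C₁ C₂ → IsMaximalGlue F* F (mirror C₁) C₂
  twins⇒maximalGlue* {C₁} {C₂} tw@(c₁ , c₂ , S≗) = mirror-base c₁ , c₂ , max
    where
    max : ∀ P' R' → F* P' → F R' → glue (mirror C₁) C₂ ⊆ glue P' R' → glue P' R' ⊆ glue (mirror C₁) C₂
    max P' R' p' r' C⊆P'R' = λ where
        (inj₁ b)        x → ⊆-∁ (proj₁ squeeze) b (trans (not-involutive _) x)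
        (inj₂ (inj₁ a)) _ → middle-full a
        (inj₂ (inj₂ b)) x → proj₂ squeeze b x
      where
      middle-full : ∀ a → not (C₁ (inj₁ a)) ∨ C₂ (inj₁ a) ≡ true
      middle-full a = trans (cong (λ v → not v ∨ C₂ (inj₁ a)) (S≗ a)) (Bool.∨-inverseˡ (C₂ (inj₁ a)))
      D₁ = mirror P'
      Dˢ⊆R'ˢ : (D₁ ∘ inj₁) ⊆ (R' ∘ inj₁)
      Dˢ⊆R'ˢ a x = ∨-resolveˡ (C⊆P'R' (inj₂ (inj₁ a)) (middle-full a)) (not≡true x)
      squeeze = count-squeeze {c₁ = C₁ ∘ inj₂} {C₂ ∘ inj₂} {D₁ ∘ inj₂} {R' ∘ inj₂} (twins-Q-size tw)
                  (bases-S≤⇒Q≥ p' r' (count-mono Dˢ⊆R'ˢ))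
                  (∁⊆-sym (λ b → C⊆P'R' (inj₁ b))) (λ b → C⊆P'R' (inj₂ (inj₂ b)))

  base-with-S-part : ∀ {D₁ D₂} → F D₁ → F D₂ → (D₂ ∘ inj₁) ⊆ (D₁ ∘ inj₁) →
                     ∃[ D ] (F D × (D ∘ inj₁) ≗ (D₂ ∘ inj₁) × (D₁ ∘ inj₂) ⊆ (D ∘ inj₂))
  base-with-S-part {D₂ = D₂} d₁ d₂ = go (<-wellFounded _) d₁
    where
    go : ∀ {D₁} → Acc _<_ (size (D₁ ∖ D₂)) → F D₁ → (D₂ ∘ inj₁) ⊆ (D₁ ∘ inj₁) →
         ∃[ D ] (F D × (D ∘ inj₁) ≗ (D₂ ∘ inj₁) × (D₁ ∘ inj₂) ⊆ (D ∘ inj₂))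
    go {D₁} (acc rec) d₁ D₂⊆D₁ with Fin.any? (λ a → a ∈? ((D₁ ∘ inj₁) ∖ (D₂ ∘ inj₁)))
    ... | no none = D₁ , d₁ , ⊆-antisym (∖-empty⇒⊆ none) D₂⊆D₁ , λ _ → id
    ... | yes (a , a∈) with ∖-member {Z = D₁ ∘ inj₁} {W = D₂ ∘ inj₁} a∈
    ...   | a∈D₁ , a∉D₂ with exchange M (inj₁ a) d₁ d₂ a∈D₁ (false≢true a∉D₂)
    ...     | y , y∈D₂ , y∉D₁ , D' , d' , sw =
      let D , d , S≗ , D'⊆D = go (rec (exchange-shrinks sw {W = D₂} a∈D₁ (false≢true a∉D₂) y∈D₂)) d'
                                 (λ a' x → swapped-keeps sw y∉D₁ (inj₁ a')
                                             (λ { refl → false≢true a∉D₂ x }) (D₂⊆D₁ a' x))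
      in D , d , S≗ , λ b x → D'⊆D b (swapped-keeps sw y∉D₁ (inj₂ b) (λ ()) x)

  maximalGlue*⇒twins : ∀ {P R} → IsMaximalGlue F* F P R → ∃[ D ] (Twins D R × twinSet D R ⊆ outer P R)
  maximalGlue*⇒twins mg@(p , r , _) with base-with-S-part p r (glue-coverʳ M mg p (λ _ → refl))
  ... | D , d , S≗ , D₁⊆D = D , (d , r , S≗) , λ where
    (inj₁ b) x → not≡false (contraposeᵇ (D₁⊆D b) (not≡true x))
    (inj₂ b) x → x

  F*-ext : Extensional F*
  F*-ext Z≗W = resp M (λ x → cong not (Z≗W (swap x)))

  outer-mirror : ∀ C₁ C₂ → outer (mirror C₁) C₂ ≗ twinSet C₁ C₂
  outer-mirror C₁ C₂ (inj₁ _) = refl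
  outer-mirror C₁ C₂ (inj₂ _) = refl

  dualLink≐twinBases : (F* ↔ᴸ F) ≐ TwinBases
  dualLink≐twinBases = ≐-trans (linking≐LinkBase F*-ext) linkBase≐twinBases
    where
    linkBase≐twinBases : LinkBase F* F ≐ TwinBases
    linkBase≐twinBases Z = to , from
      where
      to : LinkBase F* F Z → TwinBases Z
      to ((P , R , mg , o⊆Z) , min) with maximalGlue*⇒twins mg
      ... | D , tw , t⊆o = D , R , tw , ⊆-antisym Z⊆t t⊆Z
        where
        t⊆Z = ⊆-trans t⊆o o⊆Z
        Z⊆t = ⊆-trans (min (mirror D) R (twins⇒maximalGlue* tw) (⊆-trans (⊆-reflexive (outer-mirror D R)) t⊆Z))
                      (⊆-reflexive (outer-mirror D R))
      from : TwinBases Z → LinkBase F* F Z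
      from (C₁ , C₂ , tw , Z≗) =
        (mirror C₁ , C₂ , twins⇒maximalGlue* tw , o⊆Z) ,
        λ P' R' mg' o'⊆Z → let D' , tw' , t'⊆o' = maximalGlue*⇒twins mg' in
          ⊆-trans (⊆-reflexive Z≗)
            (⊆-trans (twinSet-incomparable tw tw' (⊆-trans t'⊆o' (⊆-trans o'⊆Z (⊆-reflexive Z≗)))) t'⊆o')
        where
        o⊆Z : outer (mirror C₁) C₂ ⊆ Z
        o⊆Z = ⊆-trans (⊆-reflexive (outer-mirror C₁ C₂)) (⊆-reflexive (sym ∘ Z≗))

  maximalGlue⇒twins : ∀ {P R} → IsMaximalGlue F TwinBases P R →
    ∃[ C₁ ] ∃[ C₂ ] (Twins C₁ C₂ × R ≗ twinSet C₁ C₂ × (P ∘ inj₂) ⊆ (C₁ ∘ inj₂))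
  maximalGlue⇒twins mg@(_ , (C₁ , C₂ , tw@(c₁ , _) , R≗) , _) =
    C₁ , C₂ , tw , R≗ ,
    glue-coverˡ M mg c₁ (λ b → sym (trans (cong not (R≗ (inj₁ b))) (not-involutive _)))

  twins⇒maximalGlue : ∀ {B C₁ C₂} → F B → Twins C₁ C₂ → (B ∘ inj₂) ≗ (C₁ ∘ inj₂) →
                      IsMaximalGlue F TwinBases B (twinSet C₁ C₂)
  twins⇒maximalGlue {B} {C₁} {C₂} b tw Q≗ = b , (C₁ , C₂ , tw , λ _ → refl) , max
    where
    middle-full : ∀ x → B (inj₂ x) ∨ not (C₁ (inj₂ x)) ≡ true
    middle-full x = trans (cong (λ v → v ∨ not (C₁ (inj₂ x))) (Q≗ x)) (Bool.∨-inverseʳ (C₁ (inj₂ x)))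
    max : ∀ P' R' → F P' → TwinBases R' → glue B (twinSet C₁ C₂) ⊆ glue P' R' →
          glue P' R' ⊆ glue B (twinSet C₁ C₂)
    max P' R' p' (D₁ , D₂ , twD , R'≗) ⊆glue = λ where
        (inj₁ a)        x → count-⊆-≥ Bˢ⊆P'ˢ P'ˢ≤Bˢ a x
        (inj₂ (inj₁ x)) _ → middle-full x
        (inj₂ (inj₂ x)) y → count-⊆-≥ C₂⊆D₂ D₂≤C₂ x (trans (sym (R'≗ (inj₂ x))) y)
      where
      open ≤-Reasoning
      Bˢ⊆P'ˢ : (B ∘ inj₁) ⊆ (P' ∘ inj₁)
      Bˢ⊆P'ˢ a = ⊆glue (inj₁ a)
      C₂⊆D₂ : (C₂ ∘ inj₂) ⊆ (D₂ ∘ inj₂)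
      C₂⊆D₂ x y = trans (sym (R'≗ (inj₂ x))) (⊆glue (inj₂ (inj₂ x)) y)
      D₁⊆P' : (D₁ ∘ inj₂) ⊆ (P' ∘ inj₂)
      D₁⊆P' x y = ∨-resolveʳ (⊆glue (inj₂ (inj₁ x)) (middle-full x)) (trans (R'≗ (inj₁ x)) (cong not y))
      D₂≤C₂ : ∣ D₂ ∘ inj₂ ∣ ≤ ∣ C₂ ∘ inj₂ ∣
      D₂≤C₂ = begin
        ∣ D₂ ∘ inj₂ ∣  ≡⟨ twins-Q-size twD ⟨
        ∣ D₁ ∘ inj₂ ∣  ≤⟨ count-mono D₁⊆P' ⟩
        ∣ P' ∘ inj₂ ∣  ≤⟨ bases-S≤⇒Q≥ b p' (count-mono Bˢ⊆P'ˢ) ⟩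
        ∣ B ∘ inj₂ ∣   ≡⟨ count-cong Q≗ ⟩
        ∣ C₁ ∘ inj₂ ∣  ≡⟨ twins-Q-size tw ⟩
        ∣ C₂ ∘ inj₂ ∣  ∎
      P'ˢ≤Bˢ : ∣ P' ∘ inj₁ ∣ ≤ ∣ B ∘ inj₁ ∣
      P'ˢ≤Bˢ = bases-Q≤⇒S≥ b p' (begin
        ∣ B ∘ inj₂ ∣   ≡⟨ count-cong Q≗ ⟩
        ∣ C₁ ∘ inj₂ ∣  ≡⟨ twins-Q-size tw ⟩
        ∣ C₂ ∘ inj₂ ∣  ≤⟨ count-mono C₂⊆D₂ ⟩
        ∣ D₂ ∘ inj₂ ∣  ≡⟨ twins-Q-size twD ⟨
        ∣ D₁ ∘ inj₂ ∣  ≤⟨ count-mono D₁⊆P' ⟩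
        ∣ P' ∘ inj₂ ∣  ∎)

  twins-with-Q-part : ∀ {B C₁ C₂} → F B → Twins C₁ C₂ → (B ∘ inj₂) ⊆ (C₁ ∘ inj₂) →
    ∃[ C₁' ] ∃[ C₂' ] (Twins C₁' C₂' × (C₁' ∘ inj₂) ≗ (B ∘ inj₂) × (C₂' ∘ inj₂) ⊆ (C₂ ∘ inj₂))
  twins-with-Q-part {B} b = go (<-wellFounded _)
    where
    go : ∀ {C₁ C₂} → Acc _<_ (size (C₁ ∖ B)) → Twins C₁ C₂ → (B ∘ inj₂) ⊆ (C₁ ∘ inj₂) →
      ∃[ C₁' ] ∃[ C₂' ] (Twins C₁' C₂' × (C₁' ∘ inj₂) ≗ (B ∘ inj₂) × (C₂' ∘ inj₂) ⊆ (C₂ ∘ inj₂))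
    go {C₁} {C₂} (acc rec) tw@(c₁ , c₂ , S≗) B⊆C₁
      with Fin.any? (λ x → x ∈? ((C₁ ∘ inj₂) ∖ (B ∘ inj₂)))
    ... | no none = C₁ , C₂ , tw , ⊆-antisym (∖-empty⇒⊆ none) B⊆C₁ , λ _ → id
    ... | yes (x , x∈) with ∖-member {Z = C₁ ∘ inj₂} {W = B ∘ inj₂} x∈
    ...   | x∈C₁ , x∉B with exchange M (inj₂ x) c₁ b x∈C₁ (false≢true x∉B)
    ...     | inj₂ y , y∈B , y∉C₁ , _ = ⊥-elim (y∉C₁ (B⊆C₁ y y∈B))
    ...     | inj₁ a , a∈B , a∉C₁ , C₁' , c₁' , sw₁
      with exchange-into (inj₁ a) c₂ c₁' (proj₁ sw₁) (λ a∈C₂ → a∉C₁ (trans (S≗ a) a∈C₂))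
    ...       | inj₁ a' , a'∈C₂ , a'∉C₁' , _ =
      ⊥-elim (a'∉C₁' (swapped-keeps sw₁ a∉C₁ (inj₁ a') (λ ()) (trans (S≗ a') a'∈C₂)))
    ...       | inj₂ z , _ , _ , C₂' , c₂' , sw₂ =
      let C₁'' , C₂'' , tw'' , Q≗ , C₂''⊆C₂' =
            go (rec (exchange-shrinks sw₁ {W = B} x∈C₁ (false≢true x∉B) a∈B)) (c₁' , c₂' , S≗') B⊆C₁'
      in C₁'' , C₂'' , tw'' , Q≗ ,
         λ w w∈C₂'' → swapped-back sw₂ (inj₂ w) (λ ()) (C₂''⊆C₂' w w∈C₂'')
      where
      S≗' : (C₁' ∘ inj₁) ≗ (C₂' ∘ inj₁)
      S≗' a'' with a'' Fin.≟ a
      ... | yes refl  = trans (proj₁ sw₁) (sym (proj₁ sw₂))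
      ... | no  a''≢a = trans (proj₂ (proj₂ sw₁) (inj₁ a'') (λ ()) a''≢a')
                              (trans (S≗ a'') (sym (proj₂ (proj₂ sw₂) (inj₁ a'') (λ ()) a''≢a')))
        where a''≢a' = a''≢a ∘ Sum.inj₁-injective
      B⊆C₁' : (B ∘ inj₂) ⊆ (C₁' ∘ inj₂)
      B⊆C₁' w w∈B = swapped-keeps sw₁ a∉C₁ (inj₂ w) (λ { refl → true≢false w∈B x∉B }) (B⊆C₁ w w∈B)

  linkBase⇒completion : ∀ {Z} → LinkBase F TwinBases Z → completion F Z
  linkBase⇒completion {Z} ((P , R , mg@(p , _) , o⊆Z) , min) with maximalGlue⇒twins mg
  ... | C₁ , C₂ , tw , R≗ , P⊆C₁ with twins-with-Q-part p tw P⊆C₁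
  ...   | C₁' , C₂' , tw'@(c₁' , c₂' , S≗') , Q≗ , C₂'⊆C₂ =
    C₁' ∘ inj₁ , C₁' ∘ inj₂ ,
    resp M (λ { (inj₁ _) → refl ; (inj₂ _) → refl }) c₁' ,
    resp M (λ { (inj₁ a) → sym (Z≗o' (inj₁ a)) ; (inj₂ x) → sym (Q≗ x) }) p ,
    resp M (λ { (inj₁ a) → sym (S≗' a) ; (inj₂ x) → sym (Z≗o' (inj₂ x)) }) c₂'
    where
    o'⊆Z : outer P (twinSet C₁' C₂') ⊆ Z
    o'⊆Z (inj₁ a) x = o⊆Z (inj₁ a) x
    o'⊆Z (inj₂ x) y = o⊆Z (inj₂ x) (trans (R≗ (inj₂ x)) (C₂'⊆C₂ x y))
    Z≗o' : Z ≗ outer P (twinSet C₁' C₂')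
    Z≗o' = ⊆-antisym (min P (twinSet C₁' C₂') (twins⇒maximalGlue p tw' (sym ∘ Q≗)) o'⊆Z) o'⊆Z
  completion⇒linkBase : ∀ {Z} → completion F Z → LinkBase F TwinBases Z
  completion⇒linkBase {Z} (bS , bQ , f₁ , f₂ , f₃) =
    (_ , _ , twins⇒maximalGlue f₂ tw (λ _ → refl) , λ { (inj₁ _) → id ; (inj₂ _) → id }) ,
    minimal
    where
    tw : Twins [ bS , bQ ] [ bS , Z ∘ inj₂ ]
    tw = f₁ , f₃ , λ _ → refl
    minimal : ∀ P' R' → IsMaximalGlue F TwinBases P' R' → outer P' R' ⊆ Z → Z ⊆ outer P' R'
    minimal P' R' mg'@(p' , _) o'⊆Z with maximalGlue⇒twins mg'
    ... | D₁ , D₂ , twD , R'≗ , P'⊆D₁ = λ where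
        (inj₁ a) z → count-⊆-≥ P'ˢ⊆Zˢ (proj₁ squeezed) a z
        (inj₂ x) z → trans (R'≗ (inj₂ x)) (count-⊆-≥ D₂⊆Zᑫ (proj₂ squeezed) x z)
      where
      open ≤-Reasoning
      P'ˢ⊆Zˢ : (P' ∘ inj₁) ⊆ (Z ∘ inj₁)
      P'ˢ⊆Zˢ a = o'⊆Z (inj₁ a)
      D₂⊆Zᑫ : (D₂ ∘ inj₂) ⊆ (Z ∘ inj₂)
      D₂⊆Zᑫ x d = o'⊆Z (inj₂ x) (trans (R'≗ (inj₂ x)) d)
      squeezed = ≤-squeeze (count-mono P'ˢ⊆Zˢ) (count-mono D₂⊆Zᑫ) (begin
        ∣ Z ∘ inj₁ ∣ + ∣ Z ∘ inj₂ ∣    ≡⟨ cong (∣ Z ∘ inj₁ ∣ +_) (twins-Q-size tw) ⟨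
        ∣ Z ∘ inj₁ ∣ + ∣ bQ ∣          ≡⟨ bases-equisized f₂ p' ⟩
        ∣ P' ∘ inj₁ ∣ + ∣ P' ∘ inj₂ ∣  ≤⟨ +-monoʳ-≤ _ (count-mono P'⊆D₁) ⟩
        ∣ P' ∘ inj₁ ∣ + ∣ D₁ ∘ inj₂ ∣  ≡⟨ cong (∣ P' ∘ inj₁ ∣ +_) (twins-Q-size twD) ⟩
        ∣ P' ∘ inj₁ ∣ + ∣ D₂ ∘ inj₂ ∣  ∎)

  linkBase≐completion : LinkBase F TwinBases ≐ completion F
  linkBase≐completion Z = linkBase⇒completion , completion⇒linkBase

  twins-sym : ∀ {C₁ C₂} → Twins C₁ C₂ → Twins C₂ C₁
  twins-sym (c₁ , c₂ , S≗) = c₂ , c₁ , sym ∘ S≗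

  twinBases-selfDual : dual TwinBases ≐ rename swap TwinBases
  twinBases-selfDual Z =
    (λ (C₁ , C₂ , tw , ∁Z≗) → C₂ , C₁ , twins-sym tw , λ where
       (inj₁ b) → trans (sym (not-involutive _)) (cong not (∁Z≗ (inj₂ b)))
       (inj₂ b) → not-injective (∁Z≗ (inj₁ b))) ,
    (λ (C₁ , C₂ , tw , Z≗) → C₂ , C₁ , twins-sym tw , λ where
       (inj₁ b) → cong not (Z≗ (inj₂ b))
       (inj₂ b) → trans (cong not (Z≗ (inj₁ b))) (not-involutive _))

  F-ext : Extensional F
  F-ext = resp M

  dualF-ext : Extensional (dual F)
  dualF-ext Z≗W = F-ext (cong not ∘ Z≗W)

  private
    extendˡ : Subset (Fin q) → Subset (Fin q ⊎ Fin q)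
    extendˡ = Embedding.extend leftEmbedding
    extendʳ : Subset (Fin q) → Subset E
    extendʳ = Embedding.extend rightEmbedding

  dualLink-selfDual : dual (F* ↔ᴸ F) ≐ rename swap (F* ↔ᴸ F)
  dualLink-selfDual =
    ≐-trans (≐-precomp ∁ dualLink≐twinBases)
            (≐-trans twinBases-selfDual (≐-sym (≐-precomp (_∘ swap) dualLink≐twinBases)))

  dualLink-restrictL : restrictL (F* ↔ᴸ F) ≐ restrictR (dual F)
  dualLink-restrictL = restrictAlong-transfer leftEmbedding rightEmbedding
    (≐-trans (≐-precomp extendˡ (Ind-cong dualLink≐twinBases)) ind≐)
    where
    ind≐ : (Ind TwinBases ∘ extendˡ) ≐ (Ind (dual F) ∘ extendʳ)
    ind≐ I =
      (λ (W , (C₁ , _ , (c₁ , _) , W≗) , I⊆W) →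
         ∁ C₁ , F-ext (sym ∘ ∁-involutive C₁) c₁ ,
         λ { (inj₁ _) () ; (inj₂ b) i → trans (sym (W≗ (inj₁ b))) (I⊆W (inj₁ b) i) }) ,
      (λ (B , b , I⊆B) →
         twinSet (∁ B) (∁ B) , (∁ B , ∁ B , (b , b , λ _ → refl) , λ _ → refl) ,
         λ { (inj₁ x) i → trans (not-involutive _) (I⊆B (inj₂ x) i) ; (inj₂ _) () })

  dualLink-contractL : contractL (F* ↔ᴸ F) ≐ contractR (dual F)
  dualLink-contractL = ≐-precomp ∁ (restrictAlong-transfer leftEmbedding rightEmbedding
    (≐-trans (≐-precomp extendˡ (Ind-cong (≐-precomp ∁ dualLink≐twinBases))) ind≐))
    where
    ind≐ : (Ind (dual TwinBases) ∘ extendˡ) ≐ (Ind (dual (dual F)) ∘ extendʳ)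
    ind≐ I =
      (λ (W , (C₁ , _ , (c₁ , _) , ∁W≗) , I⊆W) →
         C₁ , F-ext (sym ∘ ∁-involutive C₁) c₁ ,
         λ { (inj₁ _) () ; (inj₂ b) i → not-injective (trans (sym (∁W≗ (inj₁ b))) (cong not (I⊆W (inj₁ b) i))) }) ,
      (λ (B , b , I⊆B) → let b₀ = F-ext (∁-involutive B) b in
         ∁ (twinSet B B) ,
         (B , B , (b₀ , b₀ , λ _ → refl) , ∁-involutive (twinSet B B)) ,
         λ { (inj₁ x) i → trans (not-involutive _) (I⊆B (inj₂ x) i) ; (inj₂ _) () })

  link≐completion : (F ↔ᴸ (F* ↔ᴸ F)) ≐ completion F
  link≐completion = ≐-trans (linking≐LinkBase F-ext)
                            (≐-trans (LinkBase-congʳ dualLink≐twinBases) linkBase≐completion)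

  private
    L = F ↔ᴸ (F* ↔ᴸ F)

  base⇒link : ∀ Z → F Z → L Z
  base⇒link Z = proj₂ (link≐completion Z) ∘ base⇒completion F-ext

  link-restrictL : restrictL L ≐ restrictL F
  link-restrictL = restrictAlong-transfer leftEmbedding leftEmbedding
    (≐-trans (≐-precomp _ (Ind-cong link≐completion)) (completion-Indˡ F-ext))

  link-restrictR : restrictR L ≐ restrictR F
  link-restrictR = restrictAlong-transfer rightEmbedding rightEmbedding
    (≐-trans (≐-precomp _ (Ind-cong link≐completion)) (completion-Indʳ F-ext))

  dualLink≐completionDual : dual L ≐ completion (dual F)
  dualLink≐completionDual = ≐-trans (≐-precomp ∁ link≐completion) (completion-dual F-ext)

  link-contractL : contractL L ≐ contractL F
  link-contractL = ≐-precomp ∁ (restrictAlong-transfer leftEmbedding leftEmbedding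
    (≐-trans (≐-precomp _ (Ind-cong dualLink≐completionDual)) (completion-Indˡ dualF-ext)))

  link-contractR : contractR L ≐ contractR F
  link-contractR = ≐-precomp ∁ (restrictAlong-transfer rightEmbedding rightEmbedding
    (≐-trans (≐-precomp _ (Ind-cong dualLink≐completionDual)) (completion-Indʳ dualF-ext)))

theorem26 : (s q : ℕ) (M : Matroid (Fin s ⊎ Fin q)) →
    let F = IsBase M
        MQQ' = rename swap (dual F) ↔ᴸ F
        L = F ↔ᴸ MQQ'
    in (dual MQQ' ≐ rename swap MQQ')
     × ((restrictL MQQ' ≐ restrictR (dual F)) × (contractL MQQ' ≐ contractR (dual F)))
     × ((restrictL L ≐ restrictL F) × (restrictR L ≐ restrictR F))
     × ((contractL L ≐ contractL F) × (contractR L ≐ contractR F))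
     × (∀ Z → F Z → L Z)
     × ((completion F ≐ L) × (L ≐ (F ↔ᴸ (rename swap (dual F) ↔ᴸ F))))
     × (dual (completion F) ≐ completion (dual F))
theorem26 s q M =
  dualLink-selfDual ,
  (dualLink-restrictL , dualLink-contractL) ,
  (link-restrictL , link-restrictR) ,
  (link-contractL , link-contractR) ,
  base⇒link ,
  (≐-sym link≐completion , ≐-refl) ,
  completion-dual F-ext
  where open Completion M
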